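{- Let $\mathcal{P}$ be a finite bounded poset with least element $\hat{0}$ and greatest element $\hat{1}$. The $m$-cover poset $\mathcal{P}^{\langle m\rangle}$ is a lattice for all integers $m>0$ if and only if the Hasse diagram of $\mathcal{P}$ with $\hat{0}$ removed is a tree rooted at $\hat{1}$.
   Context: For a finite bounded poset $\mathcal{P}=(P,\leq)$ with least element $\hat 0$ and an integer $m>0$, write $(\hat{0}^{l_0},p_1^{l_1},p_2^{l_2})$ for the $m$-tuple consisting of $l_0$ copies of $\hat0$, followed by $l_1$ copies of $p_1$, followed by $l_2$ copies of $p_2$ ($l_0+l_1+l_2=m$). The $m$-cover poset $\mathcal{P}^{\langle m\rangle}$ is the subposet of the $m$-fold direct product $\mathcal{P}^m$ (ordered componentwise) whose elements are the multichains $x_1\leq x_2\leq\cdots\leq x_m$ of $\mathcal{P}$ such that the set $\{x_1,\ldots,x_m\}\setminus\{\hat 0\}$ is empty, a single element, or a two-element set $\{p,q\}$ with $p\lessdot q$ ($q$ covers $p$ in $\mathcal{P}$); i.e. the tuples $(\hat{0}^{l_0},p^{l_1},q^{l_2})$ with $p\lessdot q$ (or with at most one non-$\hat0$ value). -}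

module Defs where

open import Level using (0ℓ)
open import Data.Nat using (ℕ; _≤_)
open import Data.Fin using (Fin)
import Data.Fin as F
open import Data.List using (List; []; _∷_; _∷ʳ_; length)
open import Data.List.Relation.Unary.All using (All)
open import Data.List.Relation.Unary.Unique.Propositional using (Unique)
open import Data.List.Relation.Unary.Linked using (Linked)
open import Data.Product using (Σ; ∃; _×_; _,_)
open import Data.Sum using (_⊎_)
open import Data.Empty using (⊥)
open import Relation.Nullary using (¬_)
open import Relation.Binary using (Rel; IsDecPartialOrder)
open import Relation.Binary.PropositionalEquality using (_≡_; _≢_)

record FinBoundedPoset : Set₁ where
  field
    n                 : ℕ
    _≼_               : Rel (Fin n) 0ℓ
    isDecPartialOrder : IsDecPartialOrder _≡_ _≼_
    0̂                 : Fin n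
    1̂                 : Fin n
    0̂-least           : ∀ x → 0̂ ≼ x
    1̂-greatest        : ∀ x → x ≼ 1̂

module _ (P : FinBoundedPoset) where
  open FinBoundedPoset P

  _≺_ : Rel (Fin n) 0ℓ
  p ≺ q = p ≼ q × p ≢ q

  _⋖_ : Rel (Fin n) 0ℓ
  p ⋖ q = p ≺ q × (∀ r → p ≺ r → r ≺ q → ⊥)

  Tuple : ℕ → Set
  Tuple m = Fin m → Fin n

  _≤ᵐ_ : ∀ {m} → Tuple m → Tuple m → Set
  x ≤ᵐ y = ∀ i → x i ≼ y i

  IsMultichain : ∀ {m} → Tuple m → Set
  IsMultichain x = ∀ i j → i F.≤ j → x i ≼ x j

  InSupport : ∀ {m} → Tuple m → Fin n → Set
  InSupport x v = (∃ λ i → x i ≡ v) × v ≢ 0̂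

  CoverShape : ∀ {m} → Tuple m → Set
  CoverShape x =
      (∀ v → ¬ InSupport x v)
    ⊎ (∃ λ p → ∀ v → (InSupport x v → v ≡ p) × (v ≡ p → InSupport x v))
    ⊎ (∃ λ p → ∃ λ q → p ⋖ q ×
         (∀ v → (InSupport x v → v ≡ p ⊎ v ≡ q) × (v ≡ p ⊎ v ≡ q → InSupport x v)))

  InCoverPoset : (m : ℕ) → Tuple m → Set
  InCoverPoset m x = IsMultichain x × CoverShape x

  IsJoinIn : (m : ℕ) → Tuple m → Tuple m → Tuple m → Set
  IsJoinIn m x y z = InCoverPoset m z × x ≤ᵐ z × y ≤ᵐ z ×
    (∀ w → InCoverPoset m w → x ≤ᵐ w → y ≤ᵐ w → z ≤ᵐ w)

  IsMeetIn : (m : ℕ) → Tuple m → Tuple m → Tuple m → Set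
  IsMeetIn m x y z = InCoverPoset m z × z ≤ᵐ x × z ≤ᵐ y ×
    (∀ w → InCoverPoset m w → w ≤ᵐ x → w ≤ᵐ y → w ≤ᵐ z)

  CoverPosetIsLattice : ℕ → Set
  CoverPosetIsLattice m = ∀ x y → InCoverPoset m x → InCoverPoset m y →
    (∃ λ z → IsJoinIn m x y z) × (∃ λ z → IsMeetIn m x y z)

  -- Hasse diagram of P with 0̂ removed, as an undirected simple graph:
  -- vertices are the elements ≠ 0̂, edges are the covering pairs.

  Vertex : Fin n → Set
  Vertex v = v ≢ 0̂

  Adj : Rel (Fin n) 0ℓ
  Adj u v = u ⋖ v ⊎ v ⋖ u

  data Walk : Fin n → Fin n → Set where
    stop : ∀ {u} → Vertex u → Walk u u
    step : ∀ {u w v} → Vertex u → Adj u w → Walk w v → Walk u v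

  Connected : Set
  Connected = ∀ u v → Vertex u → Vertex v → Walk u v

  -- a cycle: distinct vertices c₀, c₁, …, c_k (k ≥ 2), consecutive ones
  -- adjacent and c_k adjacent to c₀
  IsCycle : List (Fin n) → Set
  IsCycle [] = ⊥
  IsCycle (c ∷ cs) = 2 ≤ length cs × Unique (c ∷ cs) × All Vertex (c ∷ cs)
                     × Linked Adj ((c ∷ cs) ∷ʳ c)

  Acyclic : Set
  Acyclic = ∀ cs → ¬ IsCycle cs

  HasseMinusBottomIsTreeRootedAtTop : Set
  HasseMinusBottomIsTreeRootedAtTop = Vertex 1̂ × Connected × Acyclic

-- A vertex v ≠ 0̂ with two distinct upper covers y, z closes a cycle in the Hasse diagram
-- of P ∖ {0̂}: climb by covers from y to a minimal common upper bound j, then descend from j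
-- to z. Conversely, at a minimal vertex of a cycle both cycle-neighbours are distinct upper
-- covers. As every vertex climbs to 1̂, the diagram is always connected, so it is a tree
-- exactly when upper covers of nonzero elements are unique.
-- If P^⟨2⟩ is a lattice, the join of (v,y) and (v,z) rules out such branching. If upper
-- covers are unique, the elements above a nonzero element form a chain; then meets in P^⟨m⟩
-- are componentwise, and the join is the componentwise join with every entry rounded up to
-- 0̂, to the last entry t, or to the unique coatom of t above it.
module Submission where

open import Defs hiding (_≺_; _⋖_; _≤ᵐ_)
import Defs
open import Level using (Level)
open import Function using (flip; _∘_)
open import Data.Empty using (⊥-elim)
open import Data.Product using (∃; ∃-syntax; _×_; _,_; proj₁; proj₂)
open import Data.Sum using (_⊎_; inj₁; inj₂; [_,_]′)
import Data.Sum
open import Data.Nat using (ℕ; suc; _<_; _≤_; s≤s; z≤n)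
open import Data.Nat.Properties using (suc-injective)
open import Data.Fin using (Fin; zero; suc; _≟_; fromℕ)
open import Data.Fin.Properties using (any?; ≤fromℕ; ≤-total)
open import Data.Fin.Induction using (spo-wellFounded; spo-noetherian)
open import Data.List using (List; []; _∷_; _++_; _∷ʳ_; [_])
open import Data.List.Properties using (++-assoc)
open import Data.List.Membership.Propositional using (_∈_)
open import Data.List.Membership.Propositional.Properties using (∈-∃++; ∈-length; ∈-++⁺ˡ; ∈-++⁺ʳ)
open import Data.List.Relation.Unary.All as All using (All; []; _∷_)
import Data.List.Relation.Unary.All.Properties as All
open import Data.List.Relation.Unary.Any using (here; there)
open import Data.List.Relation.Unary.AllPairs as AllPairs using (_∷_)
open import Data.List.Relation.Unary.Linked as Linked using (Linked; []; [-]; _∷_)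
open import Data.List.Relation.Unary.Linked.Properties using (Linked⇒AllPairs)
open import Data.List.Relation.Unary.Unique.Propositional using (Unique)
import Data.List.Relation.Unary.Unique.Propositional.Properties as Unique
open import Data.List.Relation.Binary.Disjoint.Propositional using (Disjoint)
open import Data.List.Relation.Binary.Permutation.Propositional using (_↭_; ↭-sym; ↭⇒↭ₛ)
open import Data.List.Relation.Binary.Permutation.Propositional.Properties
  using (++-comm; ↭-length; All-resp-↭; ∈-resp-↭)
open import Data.List.Relation.Binary.Permutation.Setoid.Properties using (Unique-resp-↭)
open import Induction.WellFounded using (WellFounded; Acc; acc)
open import Relation.Nullary using (¬_; Dec; yes; no; ¬?)
open import Relation.Nullary.Decidable using (_×-dec_)
open import Relation.Unary using (Pred)
open import Relation.Binary using (Rel; Decidable; Transitive; Poset; IsDecPartialOrder)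
import Relation.Binary.Construct.NonStrictToStrict
import Relation.Binary.Properties.Poset
open import Relation.Binary.PropositionalEquality
  using (_≡_; _≢_; refl; sym; trans; cong; subst; setoid; module ≡-Reasoning)

private
  variable
    a ℓ q : Level

module _ {k} {_⊏_ : Rel (Fin k) ℓ} (⊏-wellFounded : WellFounded _⊏_) (_⊏?_ : Decidable _⊏_)
         {Q : Pred (Fin k) q} (Q? : ∀ r → Dec (Q r)) where

  ∃-minimal : ∀ {x} → Q x → ∃[ m ] Q m × (∀ {r} → Q r → ¬ r ⊏ m)
  ∃-minimal {x} = go (⊏-wellFounded x)
    where
    go : ∀ {x} → Acc _⊏_ x → Q x → ∃[ m ] Q m × (∀ {r} → Q r → ¬ r ⊏ m)
    go {x} (acc smaller) Qx with any? (λ r → Q? r ×-dec r ⊏? x)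
    ... | yes (r , Qr , r⊏x) = go (smaller r⊏x) Qr
    ... | no ∄r              = x , Qx , λ Qr r⊏x → ∄r (_ , Qr , r⊏x)

module _ {A : Set a} {R : Rel A ℓ} where

  Linked-join : ∀ xs {x} ys → Linked R (xs ∷ʳ x) → Linked R (x ∷ ys) → Linked R (xs ++ x ∷ ys)
  Linked-join []           ys _           Rxys = Rxys
  Linked-join (_ ∷ [])     ys (Rxy ∷ _)   Rxys = Rxy ∷ Rxys
  Linked-join (_ ∷ _ ∷ xs) ys (Rxy ∷ Rxs) Rxys = Rxy ∷ Linked-join (_ ∷ xs) ys Rxs Rxys

  Linked-split : ∀ xs {x} ys → Linked R (xs ++ x ∷ ys) → Linked R (xs ∷ʳ x) × Linked R (x ∷ ys)
  Linked-split []           ys Rxys        = [-] , Rxys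
  Linked-split (_ ∷ [])     ys (Rxy ∷ Rys) = Rxy ∷ [-] , Rys
  Linked-split (_ ∷ _ ∷ xs) ys (Rxy ∷ Rxs) =
    let Rxs′ , Rys = Linked-split (_ ∷ xs) ys Rxs in Rxy ∷ Rxs′ , Rys

  Linked-rotate : ∀ {x y} xs ys →
                  Linked R ((x ∷ xs ++ y ∷ ys) ∷ʳ x) → Linked R ((y ∷ ys ++ x ∷ xs) ∷ʳ y)
  Linked-rotate {x} {y} xs ys R-closed =
    subst (Linked R) (sym (++-assoc (y ∷ ys) (x ∷ xs) [ y ]))
      (Linked-join (y ∷ ys) (xs ∷ʳ y) R-y⋯x R-x⋯y)
    where
    halves = Linked-split (x ∷ xs) (ys ∷ʳ x)
               (subst (Linked R) (++-assoc (x ∷ xs) (y ∷ ys) [ x ]) R-closed)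
    R-x⋯y = proj₁ halves
    R-y⋯x = proj₂ halves

  Linked-∃-predecessor : ∀ {x} xs {y} → Linked R ((x ∷ xs) ∷ʳ y) → ∃[ e ] e ∈ x ∷ xs × R e y
  Linked-∃-predecessor []       (Rxy ∷ [-]) = _ , here refl , Rxy
  Linked-∃-predecessor (_ ∷ xs) (_ ∷ Rxs)   =
    let e , e∈ , Rey = Linked-∃-predecessor xs Rxs in e , there e∈ , Rey

  Linked⇒Unique : Transitive R → (∀ {x} → ¬ R x x) → ∀ {xs} → Linked R xs → Unique xs
  Linked⇒Unique R-trans R-irrefl = AllPairs.map (λ { Rxy refl → R-irrefl Rxy }) ∘ Linked⇒AllPairs R-trans

module _ (P : FinBoundedPoset) where
  open FinBoundedPoset P
  open IsDecPartialOrder isDecPartialOrder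
    using (isPartialOrder; antisym; _≤?_; ≤-respˡ-≈; ≤-respʳ-≈)
    renaming (refl to ≼-refl; reflexive to ≼-reflexive; trans to ≼-trans)
  open import Data.List.Membership.DecPropositional (_≟_ {n}) using (_∈?_)

  infix 4 _≺_ _⋖_ _≤ᵐ_

  _≺_ : Rel (Fin n) _
  _≺_ = Defs._≺_ P

  _⋖_ : Rel (Fin n) _
  _⋖_ = Defs._⋖_ P

  _≤ᵐ_ : ∀ {m} → Tuple P m → Tuple P m → Set
  _≤ᵐ_ = Defs._≤ᵐ_ P

  private
    poset : Poset _ _ _
    poset = record { isPartialOrder = isPartialOrder }

    module Strict = Relation.Binary.Construct.NonStrictToStrict _≡_ _≼_

  open Relation.Binary.Properties.Poset poset
    using (<-isStrictPartialOrder; <-trans; <-irrefl; <-asym; <⇒≉; <⇒≱)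

  _≺?_ : Decidable _≺_
  _≺?_ = Strict.<-decidable _≟_ _≤?_

  ≺⇒≼ : ∀ {u w} → u ≺ w → u ≼ w
  ≺⇒≼ = Strict.<⇒≤

  ≺-≼-trans : ∀ {u v w} → u ≺ v → v ≼ w → u ≺ w
  ≺-≼-trans = Strict.<-≤-trans sym ≼-trans antisym ≤-respʳ-≈

  ≼-≺-trans : ∀ {u v w} → u ≼ v → v ≺ w → u ≺ w
  ≼-≺-trans = Strict.≤-<-trans ≼-trans antisym ≤-respˡ-≈

  ≼⇒≡⊎≺ : ∀ {u w} → u ≼ w → u ≡ w ⊎ u ≺ w
  ≼⇒≡⊎≺ {u} {w} u≼w with u ≟ w
  ... | yes u≡w = inj₁ u≡w
  ... | no  u≢w = inj₂ (u≼w , u≢w)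

  ≺-wellFounded : WellFounded _≺_
  ≺-wellFounded = spo-wellFounded <-isStrictPartialOrder

  ≺-noetherian : WellFounded (flip _≺_)
  ≺-noetherian = spo-noetherian <-isStrictPartialOrder

  ≢0̂-upward : ∀ {u w} → u ≢ 0̂ → u ≼ w → w ≢ 0̂
  ≢0̂-upward u≢0̂ u≼w refl = u≢0̂ (antisym u≼w (0̂-least _))

  ¬≺0̂ : ∀ {u} → ¬ u ≺ 0̂
  ¬≺0̂ u≺0̂ = <⇒≱ u≺0̂ (0̂-least _)

  ⋖∧≺∧≼⇒≡ : ∀ {u v w} → u ⋖ w → u ≺ v → v ≼ w → v ≡ w
  ⋖∧≺∧≼⇒≡ (_ , no-between) u≺v v≼w with ≼⇒≡⊎≺ v≼w
  ... | inj₁ v≡w = v≡w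
  ... | inj₂ v≺w = ⊥-elim (no-between _ u≺v v≺w)

  ⋖∧≼∧≺⇒≡ : ∀ {u v w} → u ⋖ w → u ≼ v → v ≺ w → u ≡ v
  ⋖∧≼∧≺⇒≡ (_ , no-between) u≼v v≺w with ≼⇒≡⊎≺ u≼v
  ... | inj₁ u≡v = u≡v
  ... | inj₂ u≺v = ⊥-elim (no-between _ u≺v v≺w)

  ⋖-squeeze : ∀ {u v w} → u ⋖ w → u ≺ v → v ≼ w → u ⋖ v
  ⋖-squeeze u⋖w u≺v v≼w = subst (_ ⋖_) (sym (⋖∧≺∧≼⇒≡ u⋖w u≺v v≼w)) u⋖w

  Between : Fin n → Fin n → Fin n → Set
  Between u w r = u ≺ r × r ≺ w

  ∃-cover-above : ∀ {u w} → u ≺ w → ∃[ c ] u ⋖ c × c ≼ w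
  ∃-cover-above {u} {w} u≺w
    with ∃-minimal ≺-wellFounded _≺?_ (λ r → (u ≺? r) ×-dec (r ≤? w)) (u≺w , ≼-refl)
  ... | c , (u≺c , c≼w) , c-minimal =
    c , (u≺c , λ r u≺r r≺c → c-minimal (u≺r , ≼-trans (≺⇒≼ r≺c) c≼w) r≺c) , c≼w

  ∃-cover-below : ∀ {u w} → u ≺ w → ∃[ c ] u ≼ c × c ⋖ w
  ∃-cover-below {u} {w} u≺w
    with ∃-minimal ≺-noetherian (flip _≺?_) (λ r → (u ≤? r) ×-dec (r ≺? w)) (≼-refl , u≺w)
  ... | c , (u≼c , c≺w) , c-maximal =
    c , u≼c , (c≺w , λ r c≺r r≺w → c-maximal (≼-trans u≼c (≺⇒≼ c≺r) , r≺w) c≺r)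

  ascending-cover-chain : ∀ {u w} → u ≺ w → ∃[ cs ] Linked _⋖_ (u ∷ cs ∷ʳ w) × All (Between u w) cs
  ascending-cover-chain {u} {w} = go (≺-noetherian u)
    where
    go : ∀ {u} → Acc (flip _≺_) u → u ≺ w → ∃[ cs ] Linked _⋖_ (u ∷ cs ∷ʳ w) × All (Between u w) cs
    go (acc above) u≺w with ∃-cover-above u≺w
    ... | c , u⋖c@(u≺c , _) , c≼w with ≼⇒≡⊎≺ c≼w
    ...   | inj₁ refl = [] , u⋖c ∷ [-] , []
    ...   | inj₂ c≺w  =
      let cs , chain , between = go (above u≺c) c≺w
      in c ∷ cs , u⋖c ∷ chain ,
         (u≺c , c≺w) ∷ All.map (λ (c≺r , r≺w) → <-trans u≺c c≺r , r≺w) between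

  descending-cover-chain : ∀ {u w} → u ≺ w →
                           ∃[ cs ] Linked (flip _⋖_) (w ∷ cs ∷ʳ u) × All (Between u w) cs
  descending-cover-chain {u} {w} = go (≺-wellFounded w)
    where
    go : ∀ {w} → Acc _≺_ w → u ≺ w → ∃[ cs ] Linked (flip _⋖_) (w ∷ cs ∷ʳ u) × All (Between u w) cs
    go (acc below) u≺w with ∃-cover-below u≺w
    ... | c , u≼c , c⋖w@(c≺w , _) with ≼⇒≡⊎≺ u≼c
    ...   | inj₁ refl = [] , c⋖w ∷ [-] , []
    ...   | inj₂ u≺c  =
      let cs , chain , between = go (below c≺w) u≺c
      in c ∷ cs , c⋖w ∷ chain ,
         (u≺c , c≺w) ∷ All.map (λ (u≺r , r≺c) → u≺r , <-trans r≺c c≺w) between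

  walk-start : ∀ {u v} → Walk P u v → Vertex P u
  walk-start (stop u∈) = u∈
  walk-start (step u∈ _ _) = u∈

  walk-++ : ∀ {u v w} → Walk P u v → Walk P v w → Walk P u w
  walk-++ (stop _) q = q
  walk-++ (step u∈ u~u′ p) q = step u∈ u~u′ (walk-++ p q)

  Adj-sym : ∀ {u v} → Adj P u v → Adj P v u
  Adj-sym (inj₁ u⋖v) = inj₂ u⋖v
  Adj-sym (inj₂ v⋖u) = inj₁ v⋖u

  walk-reverse : ∀ {u v} → Walk P u v → Walk P v u
  walk-reverse (stop u∈) = stop u∈
  walk-reverse (step u∈ u~u′ p) = walk-++ (walk-reverse p) (step (walk-start p) (Adj-sym u~u′) (stop u∈))

  walk-to-1̂ : ∀ {u} → Vertex P u → Walk P u 1̂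
  walk-to-1̂ {u} = go (≺-noetherian u)
    where
    go : ∀ {u} → Acc (flip _≺_) u → Vertex P u → Walk P u 1̂
    go {u} (acc above) u≢0̂ with u ≟ 1̂
    ... | yes refl = stop u≢0̂
    ... | no  u≢1̂ with ∃-cover-above (1̂-greatest u , u≢1̂)
    ...   | c , u⋖c@(u≺c , _) , _ = step u≢0̂ (inj₁ u⋖c) (go (above u≺c) (≢0̂-upward u≢0̂ (≺⇒≼ u≺c)))

  connected : Connected P
  connected _ _ u≢0̂ v≢0̂ = walk-++ (walk-to-1̂ u≢0̂) (walk-reverse (walk-to-1̂ v≢0̂))

  StepsAreCovers : ∀ {m} → Tuple P m → Set
  StepsAreCovers x = ∀ i j → x i ≢ 0̂ → x i ≺ x j → x i ⋖ x j

  ⋖-pair-steps : ∀ {p q a b} → p ⋖ q → a ≡ p ⊎ a ≡ q → b ≡ p ⊎ b ≡ q → a ≺ b → a ⋖ b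
  ⋖-pair-steps p⋖q       (inj₁ refl) (inj₂ refl) _   = p⋖q
  ⋖-pair-steps _         (inj₁ refl) (inj₁ refl) p≺p = ⊥-elim (<-irrefl refl p≺p)
  ⋖-pair-steps (p≺q , _) (inj₂ refl) (inj₁ refl) q≺p = ⊥-elim (<-asym p≺q q≺p)
  ⋖-pair-steps _         (inj₂ refl) (inj₂ refl) q≺q = ⊥-elim (<-irrefl refl q≺q)

  coverShape⇒stepsAreCovers : ∀ {m} {x : Tuple P m} → CoverShape P x → StepsAreCovers x
  coverShape⇒stepsAreCovers {x = x} shape i j xi≢0̂ xi≺xj = from shape
    where
    xj≢0̂ : x j ≢ 0̂
    xj≢0̂ = ≢0̂-upward xi≢0̂ (≺⇒≼ xi≺xj)

    in-support : ∀ {k} → x k ≢ 0̂ → InSupport P x (x k)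
    in-support {k} xk≢0̂ = (k , refl) , xk≢0̂

    from : CoverShape P x → x i ⋖ x j
    from (inj₁ empty) = ⊥-elim (empty _ (in-support xi≢0̂))
    from (inj₂ (inj₁ (p , only-p))) =
      ⊥-elim (<-irrefl (trans (proj₁ (only-p _) (in-support xi≢0̂)) (sym (proj₁ (only-p _) (in-support xj≢0̂))))
                       xi≺xj)
    from (inj₂ (inj₂ (p , q , p⋖q , only-pq))) =
      ⋖-pair-steps p⋖q (proj₁ (only-pq _) (in-support xi≢0̂)) (proj₁ (only-pq _) (in-support xj≢0̂)) xi≺xj

  ⋖-comparable⇒≡ : ∀ {u v w} → u ⋖ w → v ⋖ w → u ≼ v ⊎ v ≼ u → u ≡ v
  ⋖-comparable⇒≡ u⋖w (v≺w , _) (inj₁ u≼v) = ⋖∧≼∧≺⇒≡ u⋖w u≼v v≺w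
  ⋖-comparable⇒≡ (u≺w , _) v⋖w (inj₂ v≼u) = sym (⋖∧≼∧≺⇒≡ v⋖w v≼u u≺w)

  multichain-comparable : ∀ {m} {x : Tuple P m} → IsMultichain P x → ∀ i j → x i ≼ x j ⊎ x j ≼ x i
  multichain-comparable chain i j = Data.Sum.map (chain i j) (chain j i) (≤-total i j)

  module _ {m} {x : Tuple P (suc m)} (chain : IsMultichain P x) (steps : StepsAreCovers x) where
    private
      last : Fin (suc m)
      last = fromℕ m

      x≼last : ∀ i → x i ≼ x last
      x≼last i = chain i last (≤fromℕ i)

      ⋖last : ∀ {i} → x i ≢ 0̂ → x i ≢ x last → x i ⋖ x last
      ⋖last {i} xi≢0̂ xi≢last = steps i last xi≢0̂ (x≼last i , xi≢last)

      support⊆last : ¬ (∃[ i ] x i ≢ 0̂ × x i ≢ x last) → ∀ {v} → InSupport P x v → v ≡ x last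
      support⊆last ∄i ((i , refl) , xi≢0̂) with x i ≟ x last
      ... | yes xi≡last = xi≡last
      ... | no  xi≢last = ⊥-elim (∄i (i , xi≢0̂ , xi≢last))

      support⊆pair : ∀ {i₀} → x i₀ ⋖ x last → ∀ {v} → InSupport P x v → v ≡ x i₀ ⊎ v ≡ x last
      support⊆pair {i₀} xi₀⋖last ((j , refl) , xj≢0̂) with x j ≟ x last
      ... | yes xj≡last = inj₂ xj≡last
      ... | no  xj≢last =
        inj₁ (⋖-comparable⇒≡ (⋖last xj≢0̂ xj≢last) xi₀⋖last (multichain-comparable chain j i₀))

    stepsAreCovers⇒coverShape : CoverShape P x
    stepsAreCovers⇒coverShape with x last ≟ 0̂
    ... | yes last≡0̂ = inj₁ λ { _ ((i , refl) , xi≢0̂) → ≢0̂-upward xi≢0̂ (x≼last i) last≡0̂ }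
    ... | no  last≢0̂ with any? (λ i → ¬? (x i ≟ 0̂) ×-dec ¬? (x i ≟ x last))
    ...   | no ∄i = inj₂ (inj₁ (x last , λ _ → support⊆last ∄i , λ { refl → (last , refl) , last≢0̂ }))
    ...   | yes (i₀ , xi₀≢0̂ , xi₀≢last) = inj₂ (inj₂ (x i₀ , x last , ⋖last xi₀≢0̂ xi₀≢last , λ _ →
            support⊆pair (⋖last xi₀≢0̂ xi₀≢last) ,
            λ { (inj₁ refl) → (i₀ , refl) , xi₀≢0̂ ; (inj₂ refl) → (last , refl) , last≢0̂ }))

    multichain∧stepsAreCovers⇒∈ : InCoverPoset P (suc m) x
    multichain∧stepsAreCovers⇒∈ = chain , stepsAreCovers⇒coverShape

  UniqueUpperCovers : Set
  UniqueUpperCovers = ∀ {v y z} → v ≢ 0̂ → v ⋖ y → v ⋖ z → y ≡ z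

  pair : Fin n → Fin n → Tuple P 2
  pair u w zero       = u
  pair u w (suc zero) = w

  pair-∈ : ∀ {u w} → u ≼ w → (u ≺ w → u ⋖ w) → InCoverPoset P 2 (pair u w)
  pair-∈ {u} {w} u≼w u⋖w = multichain∧stepsAreCovers⇒∈ chain steps
    where
    chain : IsMultichain P (pair u w)
    chain zero       zero       _  = ≼-refl
    chain zero       (suc zero) _  = u≼w
    chain (suc zero) (suc zero) _  = ≼-refl
    chain (suc zero) zero       ()

    steps : StepsAreCovers (pair u w)
    steps zero       (suc zero) _ u≺w = u⋖w u≺w
    steps (suc zero) zero       _ w≺u = ⊥-elim (<⇒≱ w≺u u≼w)
    steps zero       zero       _ u≺u = ⊥-elim (<-irrefl refl u≺u)
    steps (suc zero) (suc zero) _ w≺w = ⊥-elim (<-irrefl refl w≺w)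

  ≤ᵐ-pair : ∀ {x : Tuple P 2} {u w} → x zero ≼ u → x (suc zero) ≼ w → x ≤ᵐ pair u w
  ≤ᵐ-pair x₀≼u _ zero       = x₀≼u
  ≤ᵐ-pair _ x₁≼w (suc zero) = x₁≼w

  -- With J the join of (v,y) and (v,z), w = J₂ is the join of y and z in P, and as u = J₁ is
  -- covered by w, every coatom of w above v equals u. So the coatoms of w above y and above z
  -- coincide, giving a common upper bound of y and z strictly below w.
  lattice⇒uniqueUpperCovers : CoverPosetIsLattice P 2 → UniqueUpperCovers
  lattice⇒uniqueUpperCovers lattice {v} {y} {z} v≢0̂ v⋖y@(v≺y , _) v⋖z@(v≺z , _)
    with proj₁ (lattice (pair v y) (pair v z) (pair-∈ (≺⇒≼ v≺y) λ _ → v⋖y)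
                                              (pair-∈ (≺⇒≼ v≺z) λ _ → v⋖z))
  ... | J , (_ , J-shape) , vy≤J , vz≤J , J-least = compare (≼⇒≡⊎≺ y≼w) (≼⇒≡⊎≺ z≼w)
    where
    u w : Fin n
    u = J zero
    w = J (suc zero)

    y≼w : y ≼ w
    y≼w = vy≤J (suc zero)

    z≼w : z ≼ w
    z≼w = vz≤J (suc zero)

    w-least : ∀ {r} → y ≼ r → z ≼ r → w ≼ r
    w-least {r} y≼r z≼r = J-least (pair r r) (pair-∈ ≼-refl (⊥-elim ∘ <-irrefl refl))
                                  (≤ᵐ-pair v≼r y≼r) (≤ᵐ-pair v≼r z≼r) (suc zero)
      where v≼r = ≼-trans (≺⇒≼ v≺y) y≼r

    coatom≡u : ∀ {c} → v ≼ c → c ⋖ w → u ≡ c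
    coatom≡u v≼c c⋖w@(c≺w , _) = ⋖∧≼∧≺⇒≡ u⋖w u≼c c≺w
      where
      u≼c = J-least (pair _ w) (pair-∈ (≺⇒≼ c≺w) λ _ → c⋖w) (≤ᵐ-pair v≼c y≼w) (≤ᵐ-pair v≼c z≼w) zero
      u⋖w = coverShape⇒stepsAreCovers J-shape zero (suc zero)
              (≢0̂-upward v≢0̂ (vy≤J zero)) (≼-≺-trans u≼c c≺w)

    compare : y ≡ w ⊎ y ≺ w → z ≡ w ⊎ z ≺ w → y ≡ z
    compare (inj₁ y≡w) _          = sym (⋖∧≺∧≼⇒≡ v⋖y v≺z (subst (z ≼_) (sym y≡w) z≼w))
    compare (inj₂ _)   (inj₁ z≡w) = ⋖∧≺∧≼⇒≡ v⋖z v≺y (subst (y ≼_) (sym z≡w) y≼w)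
    compare (inj₂ y≺w) (inj₂ z≺w) with ∃-cover-below y≺w | ∃-cover-below z≺w
    ... | c , y≼c , c⋖w@(c≺w , _) | d , z≼d , d⋖w =
      ⊥-elim (<⇒≱ c≺w (w-least y≼c (subst (z ≼_) d≡c z≼d)))
      where
      d≡c = trans (sym (coatom≡u (≼-trans (≺⇒≼ v≺z) z≼d) d⋖w))
                  (coatom≡u (≼-trans (≺⇒≼ v≺y) y≼c) c⋖w)

  IsCycle-rotate : ∀ c pre v post → IsCycle P (c ∷ pre ++ v ∷ post) → IsCycle P (v ∷ post ++ c ∷ pre)
  IsCycle-rotate c pre v post (long , unique , vertices , closed) =
    subst (2 ≤_) (suc-injective (↭-length rotation)) long ,
    Unique-resp-↭ (setoid (Fin n)) (↭⇒↭ₛ rotation) unique ,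
    All-resp-↭ rotation vertices ,
    Linked-rotate pre post closed
    where
    rotation : (c ∷ pre) ++ (v ∷ post) ↭ (v ∷ post) ++ (c ∷ pre)
    rotation = ++-comm (c ∷ pre) (v ∷ post)

  IsCycle-rotate-to : ∀ {cs v} → IsCycle P cs → v ∈ cs →
                      ∃[ ds ] IsCycle P (v ∷ ds) × (∀ {r} → r ∈ ds → r ∈ cs)
  IsCycle-rotate-to {c ∷ cs} cycle (here refl) = cs , cycle , there
  IsCycle-rotate-to {c ∷ cs} cycle (there v∈cs) with ∈-∃++ v∈cs
  ... | pre , post , refl =
    post ++ c ∷ pre , IsCycle-rotate c pre _ post cycle ,
    ∈-resp-↭ (↭-sym (++-comm (c ∷ pre) (_ ∷ post))) ∘ there

  Adj⇒⋖ : ∀ {u w} → Adj P u w → ¬ w ≺ u → u ⋖ w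
  Adj⇒⋖ (inj₁ u⋖w) _   = u⋖w
  Adj⇒⋖ (inj₂ w⋖u) w⊀u = ⊥-elim (w⊀u (proj₁ w⋖u))

  cycle-minimum-branches : ∀ {v ds} → IsCycle P (v ∷ ds) → (∀ {r} → r ∈ ds → ¬ r ≺ v) →
                           ¬ UniqueUpperCovers
  cycle-minimum-branches {ds = []}     (() , _)
  cycle-minimum-branches {ds = _ ∷ []} (s≤s () , _)
  cycle-minimum-branches {ds = d ∷ _ ∷ ds} (_ , _ ∷ (d∉ ∷ _) , v≢0̂ ∷ _ , v~d ∷ _ ∷ closed) minimum uuc =
    let e , e∈ , e~v = Linked-∃-predecessor ds closed
    in All.lookup d∉ e∈ (uuc v≢0̂ (Adj⇒⋖ v~d (minimum (here refl)))
                                 (Adj⇒⋖ (Adj-sym e~v) (minimum (there e∈))))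

  uniqueUpperCovers⇒acyclic : UniqueUpperCovers → Acyclic P
  uniqueUpperCovers⇒acyclic uuc (c ∷ cs) cycle =
    let v , v∈ , v-minimal = ∃-minimal ≺-wellFounded _≺?_ (_∈? c ∷ cs) (here refl)
        ds , rotated , ds⊆ = IsCycle-rotate-to cycle v∈
    in cycle-minimum-branches rotated (v-minimal ∘ ds⊆) uuc

  ∃-minimal-upperBound : ∀ u v → ∃[ j ] (u ≼ j × v ≼ j) × (∀ {r} → u ≼ r × v ≼ r → ¬ r ≺ j)
  ∃-minimal-upperBound u v =
    ∃-minimal ≺-wellFounded _≺?_ (λ r → (u ≤? r) ×-dec (v ≤? r)) (1̂-greatest u , 1̂-greatest v)

  distinct-covers-≺-upperBound : ∀ {v y z j} → v ⋖ y → v ⋖ z → y ≢ z → y ≼ j → z ≼ j → y ≺ j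
  distinct-covers-≺-upperBound v⋖y (v≺z , _) y≢z y≼j z≼j =
    y≼j , λ { refl → y≢z (sym (⋖∧≺∧≼⇒≡ v⋖y v≺z z≼j)) }

  module _ {v y z j ys zs} (v≢0̂ : v ≢ 0̂) (v⋖y : v ⋖ y) (v⋖z : v ⋖ z) (y≺j : y ≺ j) (z≺j : z ≺ j)
           (j-minimal : ∀ {r} → y ≼ r × z ≼ r → ¬ r ≺ j)
           (y⋯j : Linked _⋖_ (y ∷ ys ∷ʳ j)) (ys-between : All (Between y j) ys)
           (j⋯z : Linked (flip _⋖_) (j ∷ zs ∷ʳ z)) (zs-between : All (Between z j) zs) where
    private
      Y Z : List (Fin n)
      Y = y ∷ ys ∷ʳ j
      Z = zs ∷ʳ z

      Y-bounds : All (λ r → y ≼ r × r ≼ j) Y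
      Y-bounds = (≼-refl , ≺⇒≼ y≺j) ∷
        All.++⁺ (All.map (λ (y≺r , r≺j) → ≺⇒≼ y≺r , ≺⇒≼ r≺j) ys-between) ((≺⇒≼ y≺j , ≼-refl) ∷ [])

      Z-bounds : All (λ r → z ≼ r × r ≺ j) Z
      Z-bounds = All.++⁺ (All.map (λ (z≺r , r≺j) → ≺⇒≼ z≺r , r≺j) zs-between) ((≼-refl , z≺j) ∷ [])

      above-v : All (v ≺_) (Y ++ Z)
      above-v = All.++⁺ (All.map (≺-≼-trans (proj₁ v⋖y) ∘ proj₁) Y-bounds)
                        (All.map (≺-≼-trans (proj₁ v⋖z) ∘ proj₁) Z-bounds)

      disjoint : Disjoint Y Z
      disjoint (r∈Y , r∈Z) with All.lookup Y-bounds r∈Y | All.lookup Z-bounds r∈Z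
      ... | y≼r , _ | z≼r , r≺j = j-minimal (y≼r , z≼r) r≺j

      reassociate : ((ys ∷ʳ j) ++ Z) ∷ʳ v ≡ ys ++ j ∷ zs ++ z ∷ [ v ]
      reassociate = begin
        ((ys ∷ʳ j) ++ Z) ∷ʳ v   ≡⟨ ++-assoc (ys ∷ʳ j) Z [ v ] ⟩
        (ys ∷ʳ j) ++ (Z ∷ʳ v)   ≡⟨ ++-assoc ys [ j ] (Z ∷ʳ v) ⟩
        ys ++ j ∷ (Z ∷ʳ v)      ≡⟨ cong (λ zs′ → ys ++ j ∷ zs′) (++-assoc zs [ z ] [ v ]) ⟩
        ys ++ j ∷ zs ++ z ∷ [ v ] ∎
        where open ≡-Reasoning

    branching-cycle : IsCycle P (v ∷ Y ++ Z)
    branching-cycle =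
      s≤s (∈-length (∈-++⁺ˡ (∈-++⁺ʳ ys (here refl)))) ,
      All.map <⇒≉ above-v ∷
        Unique.++⁺ (Linked⇒Unique <-trans (<-irrefl refl) (Linked.map proj₁ y⋯j))
                   (Linked⇒Unique (flip <-trans) (<-irrefl refl) (Linked.tail (Linked.map proj₁ j⋯z)))
                   disjoint ,
      v≢0̂ ∷ All.map (≢0̂-upward v≢0̂ ∘ ≺⇒≼) above-v ,
      subst (Linked (Adj P) ∘ (v ∷_) ∘ (y ∷_)) (sym reassociate)
        (Linked-join (v ∷ y ∷ ys) (zs ++ z ∷ [ v ])
          (inj₁ v⋖y ∷ Linked.map inj₁ y⋯j)
          (Linked-join (j ∷ zs) [ v ] (Linked.map inj₂ j⋯z) (inj₂ v⋖z ∷ [-])))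

  acyclic⇒uniqueUpperCovers : Acyclic P → UniqueUpperCovers
  acyclic⇒uniqueUpperCovers acyclic {v} {y} {z} v≢0̂ v⋖y v⋖z with y ≟ z
  ... | yes y≡z = y≡z
  ... | no  y≢z with ∃-minimal-upperBound y z
  ...   | j , (y≼j , z≼j) , j-minimal =
    let y≺j = distinct-covers-≺-upperBound v⋖y v⋖z y≢z y≼j z≼j
        z≺j = distinct-covers-≺-upperBound v⋖z v⋖y (y≢z ∘ sym) z≼j y≼j
        _ , y⋯j , ys-between = ascending-cover-chain y≺j
        _ , j⋯z , zs-between = descending-cover-chain z≺j
    in ⊥-elim (acyclic _ (branching-cycle v≢0̂ v⋖y v⋖z y≺j z≺j j-minimal
                                          y⋯j ys-between j⋯z zs-between))

  step-inherited : ∀ {m} {z a : Tuple P m} → z ≤ᵐ a → StepsAreCovers a →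
                   ∀ {i j} → z i ≡ a i → z i ≢ 0̂ → z i ≺ z j → z i ⋖ z j
  step-inherited {z = z} z≤a a-steps {i} {j} zi≡ai zi≢0̂ zi≺zj =
    subst (_⋖ z j) (sym zi≡ai)
      (⋖-squeeze (a-steps i j ai≢0̂ (≺-≼-trans ai≺zj (z≤a j))) ai≺zj (z≤a j))
    where
    ai≺zj = subst (_≺ z j) zi≡ai zi≺zj
    ai≢0̂ = zi≢0̂ ∘ trans zi≡ai

  record IsSupremum (u v s : Fin n) : Set where
    field
      upperˡ : u ≼ s
      upperʳ : v ≼ s
      least  : ∀ {r} → u ≼ r → v ≼ r → s ≼ r

  record IsInfimum (u v s : Fin n) : Set where
    field
      lowerˡ   : s ≼ u
      lowerʳ   : s ≼ v
      greatest : ∀ {r} → r ≼ u → r ≼ v → r ≼ s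

  -- The join in P^⟨m⟩ rounds each entry u of the componentwise join up to 0̂, to its
  -- last entry t, or to a coatom of t above u.
  data RoundsUp (t u c : Fin n) : Set where
    bottom : u ≡ 0̂ → c ≡ 0̂ → RoundsUp t u c
    top    : u ≡ t → c ≡ t → RoundsUp t u c
    coatom : u ≢ 0̂ → u ≼ c → c ⋖ t → RoundsUp t u c

  roundUp : ∀ {t u} → u ≼ t → ∃ (RoundsUp t u)
  roundUp {t} {u} u≼t with u ≟ 0̂ | u ≟ t
  ... | yes u≡0̂ | _        = 0̂ , bottom u≡0̂ refl
  ... | no _    | yes u≡t  = t , top u≡t refl
  ... | no u≢0̂  | no u≢t   =
    let c , u≼c , c⋖t = ∃-cover-below (u≼t , u≢t) in c , coatom u≢0̂ u≼c c⋖t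

  RoundsUp⇒≼ : ∀ {t u c} → RoundsUp t u c → u ≼ c
  RoundsUp⇒≼ (bottom refl refl) = ≼-refl
  RoundsUp⇒≼ (top refl refl)    = ≼-refl
  RoundsUp⇒≼ (coatom _ u≼c _)   = u≼c

  RoundsUp⇒≼top : ∀ {t u c} → RoundsUp t u c → c ≼ t
  RoundsUp⇒≼top (bottom _ refl)        = 0̂-least _
  RoundsUp⇒≼top (top _ refl)           = ≼-refl
  RoundsUp⇒≼top (coatom _ _ (c≺t , _)) = ≺⇒≼ c≺t

  RoundsUp-steps : ∀ {t u u′ c c′} → RoundsUp t u c → RoundsUp t u′ c′ → c ≢ 0̂ → c ≺ c′ → c ⋖ c′
  RoundsUp-steps (bottom _ refl)  _                       c≢0̂ _    = ⊥-elim (c≢0̂ refl)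
  RoundsUp-steps (top _ refl)     c′-rounds               _   t≺c′ =
    ⊥-elim (<⇒≱ t≺c′ (RoundsUp⇒≼top c′-rounds))
  RoundsUp-steps (coatom _ _ _)   (bottom _ refl)         _   c≺0̂  = ⊥-elim (¬≺0̂ c≺0̂)
  RoundsUp-steps (coatom _ _ c⋖t) (top _ refl)            _   _    = c⋖t
  RoundsUp-steps (coatom _ _ c⋖t) (coatom _ _ (c′≺t , _)) _   c≺c′ = ⊥-elim (proj₂ c⋖t _ c≺c′ c′≺t)

  module _ (uuc : UniqueUpperCovers) where

    upset-total : ∀ {u y z} → u ≢ 0̂ → u ≼ y → u ≼ z → y ≼ z ⊎ z ≼ y
    upset-total {u} = go (≺-noetherian u)
      where
      go : ∀ {u y z} → Acc (flip _≺_) u → u ≢ 0̂ → u ≼ y → u ≼ z → y ≼ z ⊎ z ≼ y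
      go (acc above) u≢0̂ u≼y u≼z with ≼⇒≡⊎≺ u≼y | ≼⇒≡⊎≺ u≼z
      ... | inj₁ refl | _         = inj₁ u≼z
      ... | inj₂ _    | inj₁ refl = inj₂ u≼y
      ... | inj₂ u≺y  | inj₂ u≺z with ∃-cover-above u≺y | ∃-cover-above u≺z
      ...   | c , u⋖c@(u≺c , _) , c≼y | c′ , u⋖c′ , c′≼z with uuc u≢0̂ u⋖c u⋖c′
      ...     | refl = go (above u≺c) (≢0̂-upward u≢0̂ (≺⇒≼ u≺c)) c≼y c′≼z

    lowerCover-unique : ∀ {u c c′ t} → u ≢ 0̂ → u ≼ c → u ≼ c′ → c ⋖ t → c′ ⋖ t → c ≡ c′
    lowerCover-unique u≢0̂ u≼c u≼c′ c⋖t c′⋖t = ⋖-comparable⇒≡ c⋖t c′⋖t (upset-total u≢0̂ u≼c u≼c′)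

    ∃-supremum : ∀ u v → ∃ (IsSupremum u v)
    ∃-supremum u v with u ≟ 0̂
    ... | yes refl = v , record { upperˡ = 0̂-least v ; upperʳ = ≼-refl ; least = λ _ v≼r → v≼r }
    ... | no  u≢0̂ with ∃-minimal-upperBound u v
    ...   | s , (u≼s , v≼s) , s-minimal = s , record { upperˡ = u≼s ; upperʳ = v≼s ; least = least }
      where
      least : ∀ {r} → u ≼ r → v ≼ r → s ≼ r
      least u≼r v≼r with upset-total u≢0̂ u≼s u≼r
      ... | inj₁ s≼r = s≼r
      ... | inj₂ r≼s with ≼⇒≡⊎≺ r≼s
      ...   | inj₁ r≡s = ≼-reflexive (sym r≡s)
      ...   | inj₂ r≺s = ⊥-elim (s-minimal (u≼r , v≼r) r≺s)

    ∃-infimum : ∀ u v → ∃[ s ] IsInfimum u v s × (s ≡ u ⊎ s ≡ v ⊎ s ≡ 0̂)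
    ∃-infimum u v with u ≤? v | v ≤? u
    ... | yes u≼v | _       =
      u , record { lowerˡ = ≼-refl ; lowerʳ = u≼v ; greatest = λ r≼u _ → r≼u } , inj₁ refl
    ... | no _    | yes v≼u =
      v , record { lowerˡ = v≼u ; lowerʳ = ≼-refl ; greatest = λ _ r≼v → r≼v } , inj₂ (inj₁ refl)
    ... | no u⋠v  | no v⋠u  =
      0̂ , record { lowerˡ = 0̂-least u ; lowerʳ = 0̂-least v ; greatest = greatest } , inj₂ (inj₂ refl)
      where
      greatest : ∀ {r} → r ≼ u → r ≼ v → r ≼ 0̂
      greatest {r} r≼u r≼v with r ≟ 0̂
      ... | yes r≡0̂ = ≼-reflexive r≡0̂
      ... | no  r≢0̂ = ⊥-elim ([ u⋠v , v⋠u ]′ (upset-total r≢0̂ r≼u r≼v))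

    RoundsUp-mono : ∀ {t u u′ c c′} → u ≼ u′ → RoundsUp t u c → RoundsUp t u′ c′ → c ≼ c′
    RoundsUp-mono _    (bottom _ refl)        _                  = 0̂-least _
    RoundsUp-mono u≼u′ (top refl refl)        (bottom refl refl) = u≼u′
    RoundsUp-mono _    (top _ refl)           (top _ refl)       = ≼-refl
    RoundsUp-mono u≼u′ (top refl _)           (coatom _ u′≼c′ (c′≺t , _)) =
      ⊥-elim (<⇒≱ (≼-≺-trans u′≼c′ c′≺t) u≼u′)
    RoundsUp-mono u≼u′ (coatom u≢0̂ _ _)       (bottom refl _)    = ⊥-elim (≢0̂-upward u≢0̂ u≼u′ refl)
    RoundsUp-mono _    (coatom _ _ (c≺t , _)) (top _ refl)       = ≺⇒≼ c≺t
    RoundsUp-mono u≼u′ (coatom u≢0̂ u≼c c⋖t)   (coatom _ u′≼c′ c′⋖t) =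
      ≼-reflexive (lowerCover-unique u≢0̂ u≼c (≼-trans u≼u′ u′≼c′) c⋖t c′⋖t)

    RoundsUp-least : ∀ {t u c a b} → RoundsUp t u c → u ≼ a → t ≼ b → (a ≢ 0̂ → a ≺ b → a ⋖ b) → c ≼ a
    RoundsUp-least (bottom _ refl)    _   _   _ = 0̂-least _
    RoundsUp-least (top refl refl)    u≼a _   _ = u≼a
    RoundsUp-least (coatom u≢0̂ u≼c c⋖t@(c≺t , _)) u≼a t≼b a⋖b
      with upset-total u≢0̂ u≼a (≼-trans u≼c (≺⇒≼ c≺t))
    ... | inj₂ t≼a = ≼-trans (≺⇒≼ c≺t) t≼a
    ... | inj₁ a≼t with ≼⇒≡⊎≺ a≼t
    ...   | inj₁ refl = ≺⇒≼ c≺t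
    ...   | inj₂ a≺t = ≼-reflexive (lowerCover-unique u≢0̂ u≼c u≼a c⋖t a⋖t)
      where
      a≺b = ≺-≼-trans a≺t t≼b
      a⋖t = ⋖-squeeze (a⋖b (≢0̂-upward u≢0̂ u≼a) a≺b) a≺t t≼b

    join-∈ : ∀ {m} {x y : Tuple P (suc m)} → InCoverPoset P (suc m) x → InCoverPoset P (suc m) y →
             ∃ (IsJoinIn P (suc m) x y)
    join-∈ {m} {x} {y} (x-chain , _) (y-chain , _) =
      w , multichain∧stepsAreCovers⇒∈ w-chain w-steps ,
      (λ i → ≼-trans (upperˡ (t-sup i)) (RoundsUp⇒≼ (w-rounds i))) ,
      (λ i → ≼-trans (upperʳ (t-sup i)) (RoundsUp⇒≼ (w-rounds i))) ,
      w-least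
      where
      open IsSupremum

      t : Tuple P (suc m)
      t i = proj₁ (∃-supremum (x i) (y i))

      t-sup : ∀ i → IsSupremum (x i) (y i) (t i)
      t-sup i = proj₂ (∃-supremum (x i) (y i))

      t-chain : IsMultichain P t
      t-chain i j i≤j =
        least (t-sup i) (≼-trans (x-chain i j i≤j) (upperˡ (t-sup j)))
                        (≼-trans (y-chain i j i≤j) (upperʳ (t-sup j)))

      last : Fin (suc m)
      last = fromℕ m

      w : Tuple P (suc m)
      w i = proj₁ (roundUp (t-chain i last (≤fromℕ i)))

      w-rounds : ∀ i → RoundsUp (t last) (t i) (w i)
      w-rounds i = proj₂ (roundUp (t-chain i last (≤fromℕ i)))

      w-chain : IsMultichain P w
      w-chain i j i≤j = RoundsUp-mono (t-chain i j i≤j) (w-rounds i) (w-rounds j)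

      w-steps : StepsAreCovers w
      w-steps i j = RoundsUp-steps (w-rounds i) (w-rounds j)

      w-least : ∀ w′ → InCoverPoset P (suc m) w′ → x ≤ᵐ w′ → y ≤ᵐ w′ → w ≤ᵐ w′
      w-least w′ (_ , w′-shape) x≤w′ y≤w′ i =
        RoundsUp-least (w-rounds i) (t≤w′ i) (t≤w′ last) (coverShape⇒stepsAreCovers w′-shape i last)
        where
        t≤w′ : t ≤ᵐ w′
        t≤w′ k = least (t-sup k) (x≤w′ k) (y≤w′ k)

    meet-∈ : ∀ {m} {x y : Tuple P (suc m)} → InCoverPoset P (suc m) x → InCoverPoset P (suc m) y →
             ∃ (IsMeetIn P (suc m) x y)
    meet-∈ {m} {x} {y} (x-chain , x-shape) (y-chain , y-shape) =
      z , multichain∧stepsAreCovers⇒∈ z-chain z-steps ,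
      lowerˡ ∘ z-inf , lowerʳ ∘ z-inf ,
      λ _ _ w≤x w≤y i → greatest (z-inf i) (w≤x i) (w≤y i)
      where
      open IsInfimum

      z : Tuple P (suc m)
      z i = proj₁ (∃-infimum (x i) (y i))

      z-inf : ∀ i → IsInfimum (x i) (y i) (z i)
      z-inf i = proj₁ (proj₂ (∃-infimum (x i) (y i)))

      z-chain : IsMultichain P z
      z-chain i j i≤j =
        greatest (z-inf j) (≼-trans (lowerˡ (z-inf i)) (x-chain i j i≤j))
                           (≼-trans (lowerʳ (z-inf i)) (y-chain i j i≤j))

      z-steps : StepsAreCovers z
      z-steps i j zi≢0̂ with proj₂ (proj₂ (∃-infimum (x i) (y i)))
      ... | inj₁ zi≡xi        = step-inherited (lowerˡ ∘ z-inf) (coverShape⇒stepsAreCovers x-shape) zi≡xi zi≢0̂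
      ... | inj₂ (inj₁ zi≡yi) = step-inherited (lowerʳ ∘ z-inf) (coverShape⇒stepsAreCovers y-shape) zi≡yi zi≢0̂
      ... | inj₂ (inj₂ zi≡0̂)  = ⊥-elim (zi≢0̂ zi≡0̂)

    uniqueUpperCovers⇒lattice : ∀ m → 0 < m → CoverPosetIsLattice P m
    uniqueUpperCovers⇒lattice (suc m) _ _ _ x∈ y∈ = join-∈ x∈ y∈ , meet-∈ x∈ y∈

theorem1p1 : (P : FinBoundedPoset) → FinBoundedPoset.0̂ P ≢ FinBoundedPoset.1̂ P →
    (((m : ℕ) → 0 < m → CoverPosetIsLattice P m) → HasseMinusBottomIsTreeRootedAtTop P)
    × (HasseMinusBottomIsTreeRootedAtTop P → (m : ℕ) → 0 < m → CoverPosetIsLattice P m)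
theorem1p1 P 0̂≢1̂ = lattice⇒tree , tree⇒lattice
  where
  lattice⇒tree : (∀ m → 0 < m → CoverPosetIsLattice P m) → HasseMinusBottomIsTreeRootedAtTop P
  lattice⇒tree lattice =
    0̂≢1̂ ∘ sym , connected P ,
    uniqueUpperCovers⇒acyclic P (lattice⇒uniqueUpperCovers P (lattice 2 (s≤s z≤n)))

  tree⇒lattice : HasseMinusBottomIsTreeRootedAtTop P → ∀ m → 0 < m → CoverPosetIsLattice P m
  tree⇒lattice (_ , _ , acyclic) = uniqueUpperCovers⇒lattice P (acyclic⇒uniqueUpperCovers P acyclic)
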